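{- Let $\mathcal{U}$ be the set of all partitions and $\mathcal{D}$ the set of partitions into distinct parts. For $\pi=(\lambda_1,\lambda_2,\dots)$ let $\mathcal{O}(\pi)=\lambda_1+\lambda_3+\lambda_5+\cdots$, and let $\pi'$ denote the conjugate partition of $\pi$. Then \[\sum_{\pi\in\mathcal{U}}q^{\mathcal{O}(\pi)}=\frac{1}{(q;q)_\infty^2},\qquad \sum_{\pi\in\mathcal{D}}q^{\mathcal{O}(\pi')}=(-q;q)_\infty^2.\]
   Context: A partition is a finite weakly decreasing sequence of positive integers $\lambda_1\ge\lambda_2\ge\cdots$. The conjugate $\pi'$ has $j$-th part equal to the number of $i$ with $\lambda_i\ge j$. $(a;q)_\infty=\prod_{n\ge0}(1-aq^n)$. -}

module Defs where

open import Data.Bool using (Bool; true; false; if_then_else_)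
open import Data.Nat as ℕ using (ℕ; zero; suc; _≤_; _<_; _≥_; _>_; _≡ᵇ_; _≤?_)
open import Data.Integer as ℤ using (ℤ; +_; -_)
open import Data.List using (List; []; _∷_; length; filter; applyUpTo; foldr)
open import Data.List.Relation.Unary.All using (All)
open import Data.List.Relation.Unary.Linked using (Linked)
open import Data.List.Relation.Unary.Unique.Propositional using (Unique)
open import Data.List.Membership.Propositional using (_∈_)
open import Data.Product using (Σ; _×_)
open import Function.Bundles using (_⇔_)
open import Relation.Binary.PropositionalEquality using (_≡_)

IsPartition : List ℕ → Set
IsPartition π = All (0 <_) π × Linked _≥_ π

IsDistinctPartition : List ℕ → Set
IsDistinctPartition π = All (0 <_) π × Linked _>_ π

O : List ℕ → ℕ
O []            = 0
O (x ∷ [])      = x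
O (x ∷ _ ∷ xs)  = x ℕ.+ O xs

conj : List ℕ → List ℕ
conj []        = []
conj (x ∷ xs)  = applyUpTo (λ j → length (filter (λ y → suc j ≤? y) (x ∷ xs))) x

CountedBy : ℕ → (List ℕ → Set) → Set
CountedBy k P = Σ (List (List ℕ)) λ L →
  Unique L × (∀ π → (π ∈ L) ⇔ P π) × (length L ≡ k)

-- Formal power series over ℤ in q, as coefficient sequences

Series : Set
Series = ℕ → ℤ

_≈ₛ_ : Series → Series → Set
f ≈ₛ g = ∀ n → f n ≡ g n

fromℕseq : (ℕ → ℕ) → Series
fromℕseq c n = + (c n)

oneₛ : Series
oneₛ zero    = + 1
oneₛ (suc _) = + 0

sumℤ : List ℤ → ℤ
sumℤ = foldr ℤ._+_ (+ 0)

_*ₛ_ : Series → Series → Series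
(f *ₛ g) n = sumℤ (applyUpTo (λ k → f k ℤ.* g (n ℕ.∸ k)) (suc n))

-- the polynomial 1 - c q^(suc e)
factor : ℤ → ℕ → Series
factor c e zero    = + 1
factor c e (suc n) = if n ≡ᵇ e then - c else + 0

finPoch : ℤ → ℕ → ℕ → Series
finPoch c m zero    = oneₛ
finPoch c m (suc N) = finPoch c m N *ₛ factor c (m ℕ.+ N)

-- (c q^(m+1); q)_∞ = ∏_{k≥0} (1 - c q^(m+1+k)); its n-th coefficient
-- equals that of the finite product over k < n+1 (later factors are ≡ 1 mod q^(n+1)).
poch : ℤ → ℕ → Series
poch c m n = finPoch c m (suc n) n

qq∞ : Series
qq∞ = poch (+ 1) 0

mqq∞ : Series
mqq∞ = poch (- (+ 1)) 0

module Submission where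

-- Both sides are enumerated stage by stage, each stage contributing one factor.
-- • 𝒰: a partition with at most k parts either has at most k − 1 parts or arises by
--   adding a first column of height k to a partition with at most k parts; that column
--   adds ⌈k/2⌉ to 𝒪.  So the generating functions G_k satisfy
--   (1 − q^⌈k/2⌉) G_k = G_(k−1), and since ⌈k/2⌉ runs through 1, 1, 2, 2, 3, 3, …
--   the factors come in equal pairs, giving (q;q)_∞² · G_∞ = 1.
-- • 𝒟: for every partition 𝒪(π′) = Σᵢ ⌈λᵢ/2⌉, because a row of length y meets ⌈y/2⌉
--   of the odd-numbered columns.  A distinct partition with parts ≤ b either avoids b
--   or contains it once, so D_b = (1 + q^⌈b/2⌉) D_(b−1), giving (−q;q)_∞².

open import Defs
open import Level using (0ℓ)
open import Function using (_∘_)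
open import Function.Bundles using (mk⇔)
open import Data.Bool using (if_then_else_; true; false)
open import Data.Empty using (⊥-elim)
open import Data.Product using (Σ; _×_; _,_; proj₁)
open import Data.Sum using (inj₁; inj₂)
open import Data.Vec using ([]; _∷_)
open import Data.Fin using (zero; suc)
open import Data.Nat as ℕ
  using (ℕ; zero; suc; _+_; _∸_; _≤_; _<_; _>_; z≤n; s≤s; z<s; s<s; _≤?_; ⌊_/2⌋; ⌈_/2⌉)
import Data.Nat.Properties as ℕP
import Data.Nat.Tactic.RingSolver as ℕSolver
open import Data.Integer as ℤ using (ℤ; +_; -_)
import Data.Integer.Properties as ℤP
open import Data.Integer.Tactic.RingSolver using (solve-∀)
open import Data.List using (List; []; _∷_; _++_; map; length; drop; filter; applyUpTo)
open import Data.Nat.ListAction using (sum)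
open import Data.List.Properties using (length-++; length-map; map-∘; map-id-local)
open import Data.List.Relation.Unary.All as All using (All; []; _∷_)
open import Data.List.Relation.Unary.Any using (here)
open import Data.List.Relation.Unary.AllPairs using ([]; _∷_)
open import Data.List.Relation.Unary.Linked as Linked using (Linked; []; [-]; _∷_)
open import Data.List.Relation.Unary.Linked.Properties using (Linked⇒AllPairs)
open import Data.List.Relation.Unary.Unique.Propositional using (Unique)
import Data.List.Relation.Unary.Unique.Propositional.Properties as Unique
open import Data.List.Membership.Propositional using (_∈_; _∉_)
open import Data.List.Membership.Propositional.Properties
  using (∈-++⁻; ∈-++⁺ˡ; ∈-++⁺ʳ; ∈-map⁻; ∈-map⁺)
open import Algebra.Bundles using (CommutativeMonoid)
open import Algebra.Structures.Biased using (IsCommutativeMonoidˡ)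
open import Algebra.Properties.CommutativeSemigroup ℕP.+-commutativeSemigroup
  using () renaming (interchange to +-interchange)
open import Relation.Nullary using (yes; no; ¬_)
open import Relation.Binary.Structures using (IsEquivalence)
import Relation.Binary.Reasoning.Setoid
open import Relation.Binary.PropositionalEquality
  using (_≡_; refl; sym; trans; cong; cong₂; subst; module ≡-Reasoning)

infixl 6 _+ₛ_
_+ₛ_ : Series → Series → Series
(f +ₛ g) n = f n ℤ.+ g n

shift : Series → Series
shift f n = f (suc n)

-- The Cauchy product unfolds by peeling off the constant term of the left factor:
-- (f * g)ₙ₊₁ = f₀ gₙ₊₁ + (shift f * g)ₙ, which holds by definition.
*ₛ-zero : ∀ f g → (f *ₛ g) 0 ≡ f 0 ℤ.* g 0
*ₛ-zero f g = ℤP.+-identityʳ _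

Agree : ℕ → Series → Series → Set
Agree n f g = ∀ j → j ≤ n → f j ≡ g j

*ₛ-cong-at : ∀ n {f f′ g g′} → Agree n f f′ → Agree n g g′ → (f *ₛ g) n ≡ (f′ *ₛ g′) n
*ₛ-cong-at zero    f≡ g≡ = cong₂ (λ a b → a ℤ.* b ℤ.+ + 0) (f≡ 0 z≤n) (g≡ 0 z≤n)
*ₛ-cong-at (suc n) f≡ g≡ =
  cong₂ ℤ._+_ (cong₂ ℤ._*_ (f≡ 0 z≤n) (g≡ (suc n) ℕP.≤-refl))
              (*ₛ-cong-at n (λ j j≤n → f≡ (suc j) (s≤s j≤n))
                            (λ j j≤n → g≡ j (ℕP.m≤n⇒m≤1+n j≤n)))

*ₛ-cong-upTo : ∀ {n f f′ g g′} → Agree n f f′ → Agree n g g′ → Agree n (f *ₛ g) (f′ *ₛ g′)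
*ₛ-cong-upTo f≡ g≡ j j≤n =
  *ₛ-cong-at j (λ i i≤j → f≡ i (ℕP.≤-trans i≤j j≤n)) (λ i i≤j → g≡ i (ℕP.≤-trans i≤j j≤n))

*ₛ-cong : ∀ {f f′ g g′} → f ≈ₛ f′ → g ≈ₛ g′ → (f *ₛ g) ≈ₛ (f′ *ₛ g′)
*ₛ-cong f≈ g≈ n = *ₛ-cong-at n (λ j _ → f≈ j) (λ j _ → g≈ j)

*ₛ-congˡ : ∀ h {f g} → f ≈ₛ g → (h *ₛ f) ≈ₛ (h *ₛ g)
*ₛ-congˡ h f≈g = *ₛ-cong {h} {h} (λ _ → refl) f≈g

*ₛ-congʳ : ∀ h {f g} → f ≈ₛ g → (f *ₛ h) ≈ₛ (g *ₛ h)
*ₛ-congʳ h {f} {g} f≈g = *ₛ-cong {f} {g} {h} {h} f≈g (λ _ → refl)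

*ₛ-zeroˡ : ∀ f n → ((λ _ → + 0) *ₛ f) n ≡ + 0
*ₛ-zeroˡ f zero    = refl
*ₛ-zeroˡ f (suc n) = cong (ℤ._+_ (+ 0)) (*ₛ-zeroˡ f n)

*ₛ-identityˡ : ∀ f → (oneₛ *ₛ f) ≈ₛ f
*ₛ-identityˡ f zero    = trans (*ₛ-zero oneₛ f) (ℤP.*-identityˡ (f 0))
*ₛ-identityˡ f (suc n) =
  trans (cong (ℤ._+_ (+ 1 ℤ.* f (suc n))) (*ₛ-zeroˡ f n))
        (trans (ℤP.+-identityʳ _) (ℤP.*-identityˡ _))

*ₛ-distribʳ-+ₛ : ∀ f g h n → ((f +ₛ g) *ₛ h) n ≡ (f *ₛ h) n ℤ.+ (g *ₛ h) n
*ₛ-distribʳ-+ₛ f g h zero =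
  trans (*ₛ-zero (f +ₛ g) h)
    (trans (ℤP.*-distribʳ-+ (h 0) (f 0) (g 0)) (sym (cong₂ ℤ._+_ (*ₛ-zero f h) (*ₛ-zero g h))))
*ₛ-distribʳ-+ₛ f g h (suc n) =
  trans (cong (ℤ._+_ ((f 0 ℤ.+ g 0) ℤ.* h (suc n))) (*ₛ-distribʳ-+ₛ (shift f) (shift g) h n))
        (regroup (f 0) (g 0) (h (suc n)) _ _)
  where
  regroup : ∀ a b c x y → (a ℤ.+ b) ℤ.* c ℤ.+ (x ℤ.+ y) ≡ (a ℤ.* c ℤ.+ x) ℤ.+ (b ℤ.* c ℤ.+ y)
  regroup = solve-∀

*ₛ-scaleˡ : ∀ a f h n → ((λ i → a ℤ.* f i) *ₛ h) n ≡ a ℤ.* (f *ₛ h) n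
*ₛ-scaleˡ a f h zero =
  trans (*ₛ-zero (λ i → a ℤ.* f i) h) (trans (ℤP.*-assoc a (f 0) (h 0)) (cong (a ℤ.*_) (sym (*ₛ-zero f h))))
*ₛ-scaleˡ a f h (suc n) =
  trans (cong (ℤ._+_ (a ℤ.* f 0 ℤ.* h (suc n))) (*ₛ-scaleˡ a (shift f) h n))
        (regroup a (f 0) (h (suc n)) _)
  where
  regroup : ∀ a b c x → a ℤ.* b ℤ.* c ℤ.+ a ℤ.* x ≡ a ℤ.* (b ℤ.* c ℤ.+ x)
  regroup = solve-∀

-- Commutativity: peeling the constant term off either side gives the same expansion,
-- so the proof recurses two degrees at a time.
*ₛ-comm : ∀ f g → (f *ₛ g) ≈ₛ (g *ₛ f)
*ₛ-comm f g zero = trans (*ₛ-zero f g) (trans (ℤP.*-comm (f 0) (g 0)) (sym (*ₛ-zero g f)))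
*ₛ-comm f g (suc zero) = swap (f 0) (g 0) (f 1) (g 1)
  where
  swap : ∀ a b c d → a ℤ.* d ℤ.+ (c ℤ.* b ℤ.+ + 0) ≡ b ℤ.* c ℤ.+ (d ℤ.* a ℤ.+ + 0)
  swap = solve-∀
*ₛ-comm f g (suc (suc n)) = begin
  f 0 ℤ.* g (2 + n) ℤ.+ (shift f *ₛ g) (suc n)
    ≡⟨ cong (ℤ._+_ (f 0 ℤ.* g (2 + n))) (*ₛ-comm (shift f) g (suc n)) ⟩
  f 0 ℤ.* g (2 + n) ℤ.+ (g 0 ℤ.* f (2 + n) ℤ.+ (shift g *ₛ shift f) n)
    ≡⟨ cong (λ x → f 0 ℤ.* g (2 + n) ℤ.+ (g 0 ℤ.* f (2 + n) ℤ.+ x)) (*ₛ-comm (shift g) (shift f) n) ⟩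
  f 0 ℤ.* g (2 + n) ℤ.+ (g 0 ℤ.* f (2 + n) ℤ.+ (shift f *ₛ shift g) n)
    ≡⟨ exchange (f 0 ℤ.* g (2 + n)) (g 0 ℤ.* f (2 + n)) _ ⟩
  g 0 ℤ.* f (2 + n) ℤ.+ (f 0 ℤ.* g (2 + n) ℤ.+ (shift f *ₛ shift g) n)
    ≡⟨ cong (ℤ._+_ (g 0 ℤ.* f (2 + n))) (*ₛ-comm f (shift g) (suc n)) ⟩
  g 0 ℤ.* f (2 + n) ℤ.+ (shift g *ₛ f) (suc n) ∎
  where
  open ≡-Reasoning
  exchange : ∀ a b c → a ℤ.+ (b ℤ.+ c) ≡ b ℤ.+ (a ℤ.+ c)
  exchange = solve-∀

-- Associativity, using shift (f * g) = f₀·shift g + shift f * g.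
*ₛ-assoc : ∀ f g h → ((f *ₛ g) *ₛ h) ≈ₛ (f *ₛ (g *ₛ h))
*ₛ-assoc f g h zero =
  trans (*ₛ-zero (f *ₛ g) h) (trans (cong (ℤ._* h 0) (*ₛ-zero f g))
    (trans (ℤP.*-assoc (f 0) (g 0) (h 0))
      (trans (cong (f 0 ℤ.*_) (sym (*ₛ-zero g h))) (sym (*ₛ-zero f (g *ₛ h))))))
*ₛ-assoc f g h (suc n) = begin
  (f *ₛ g) 0 ℤ.* h (suc n) ℤ.+ (((λ i → f 0 ℤ.* g (suc i)) +ₛ (shift f *ₛ g)) *ₛ h) n
    ≡⟨ cong₂ (λ a b → a ℤ.* h (suc n) ℤ.+ b) (*ₛ-zero f g) (*ₛ-distribʳ-+ₛ (λ i → f 0 ℤ.* g (suc i)) (shift f *ₛ g) h n) ⟩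
  f 0 ℤ.* g 0 ℤ.* h (suc n) ℤ.+ (((λ i → f 0 ℤ.* g (suc i)) *ₛ h) n ℤ.+ ((shift f *ₛ g) *ₛ h) n)
    ≡⟨ cong₂ (λ a b → f 0 ℤ.* g 0 ℤ.* h (suc n) ℤ.+ (a ℤ.+ b))
             (*ₛ-scaleˡ (f 0) (shift g) h n) (*ₛ-assoc (shift f) g h n) ⟩
  f 0 ℤ.* g 0 ℤ.* h (suc n) ℤ.+ (f 0 ℤ.* (shift g *ₛ h) n ℤ.+ (shift f *ₛ (g *ₛ h)) n)
    ≡⟨ regroup (f 0) (g 0) (h (suc n)) _ _ ⟩
  f 0 ℤ.* (g 0 ℤ.* h (suc n) ℤ.+ (shift g *ₛ h) n) ℤ.+ (shift f *ₛ (g *ₛ h)) n ∎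
  where
  open ≡-Reasoning
  regroup : ∀ a b c x y → a ℤ.* b ℤ.* c ℤ.+ (a ℤ.* x ℤ.+ y) ≡ a ℤ.* (b ℤ.* c ℤ.+ x) ℤ.+ y
  regroup = solve-∀

-- Series under the Cauchy product form a commutative monoid (up to ≈ₛ),
-- which lets the monoid solver rearrange products of series.
≈ₛ-isEquivalence : IsEquivalence _≈ₛ_
≈ₛ-isEquivalence = record
  { refl  = λ _ → refl
  ; sym   = λ f≈g n → sym (f≈g n)
  ; trans = λ f≈g g≈h n → trans (f≈g n) (g≈h n)
  }

series-*-commutativeMonoid : CommutativeMonoid 0ℓ 0ℓ
series-*-commutativeMonoid = record
  { Carrier = Series
  ; _≈_ = _≈ₛ_
  ; _∙_ = _*ₛ_
  ; ε = oneₛ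
  ; isCommutativeMonoid = IsCommutativeMonoidˡ.isCommutativeMonoid record
    { isSemigroup = record
      { isMagma = record { isEquivalence = ≈ₛ-isEquivalence ; ∙-cong = *ₛ-cong }
      ; assoc   = *ₛ-assoc
      }
    ; identityˡ = *ₛ-identityˡ
    ; comm      = *ₛ-comm
    }
  }

open import Algebra.Solver.CommutativeMonoid series-*-commutativeMonoid
  using (prove; var; _⊕_)

module ≈ₛ-Reasoning = Relation.Binary.Reasoning.Setoid (CommutativeMonoid.setoid series-*-commutativeMonoid)

-- Multiplying by 1 − c q^(e+1).  By definition shift (factor c e) is the monomial
-- −c qᵉ, so the product unfolds into f plus a shifted multiple of f.
monomial : ℤ → ℕ → Series
monomial a e n = if n ℕ.≡ᵇ e then a else + 0

monomial-mul-below : ∀ a e f n → n < e → (monomial a e *ₛ f) n ≡ + 0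
monomial-mul-below a (suc e) f zero    _         = trans (*ₛ-zero (monomial a (suc e)) f) (ℤP.*-zeroˡ (f 0))
monomial-mul-below a (suc e) f (suc n) (s<s n<e) =
  cong₂ ℤ._+_ (ℤP.*-zeroˡ (f (suc n))) (monomial-mul-below a e f n n<e)

monomial-mul-at : ∀ a e f m → (monomial a e *ₛ f) (e + m) ≡ a ℤ.* f m
monomial-mul-at a zero    f zero    = *ₛ-zero (monomial a 0) f
monomial-mul-at a zero    f (suc m) =
  trans (cong (ℤ._+_ (a ℤ.* f (suc m))) (*ₛ-zeroˡ f m)) (ℤP.+-identityʳ _)
monomial-mul-at a (suc e) f m =
  trans (cong₂ ℤ._+_ (ℤP.*-zeroˡ (f (suc (e + m)))) (monomial-mul-at a e f m)) (ℤP.+-identityˡ _)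

factor-mul-below : ∀ c e f n → n ≤ e → (factor c e *ₛ f) n ≡ f n
factor-mul-below c e f zero    _         = trans (*ₛ-zero (factor c e) f) (ℤP.*-identityˡ (f 0))
factor-mul-below c e f (suc n) n<e =
  trans (cong₂ ℤ._+_ (ℤP.*-identityˡ (f (suc n))) (monomial-mul-below (- c) e f n n<e)) (ℤP.+-identityʳ _)

factor-mul-above : ∀ c e f m → (factor c e *ₛ f) (suc e + m) ≡ f (suc e + m) ℤ.+ (- c) ℤ.* f m
factor-mul-above c e f m = cong₂ ℤ._+_ (ℤP.*-identityˡ (f (suc e + m))) (monomial-mul-at (- c) e f m)

-- The infinite product is approximated by its finite truncations: factors with
-- exponent > j leave the coefficient of q^j unchanged.
finPoch-stable : ∀ c m N j → j < N → finPoch c m N j ≡ poch c m j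
finPoch-stable c m (suc N) j (s≤s j≤N) with ℕP.m≤n⇒m<n∨m≡n j≤N
... | inj₂ refl = refl
... | inj₁ j<N  = begin
  (finPoch c m N *ₛ factor c (m + N)) j ≡⟨ *ₛ-comm (finPoch c m N) (factor c (m + N)) j ⟩
  (factor c (m + N) *ₛ finPoch c m N) j ≡⟨ factor-mul-below c (m + N) (finPoch c m N) j
                                              (ℕP.≤-trans (ℕP.<⇒≤ j<N) (ℕP.m≤n+m N m)) ⟩
  finPoch c m N j                       ≡⟨ finPoch-stable c m N j j<N ⟩
  poch c m j                            ∎
  where open ≡-Reasoning

data Split (w : ℕ) : ℕ → Set where
  below : ∀ {n} → n < w → Split w n
  above : ∀ m → Split w (w + m)

split : ∀ w n → Split w n
split zero    n       = above n
split (suc w) zero    = below z<s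
split (suc w) (suc n) with split w n
... | below n<w = below (s<s n<w)
... | above m   = above m

grow-recurrence : ∀ e (E S : Series) → (∀ n → n < suc e → E n ≡ S n) →
                  (∀ m → E (suc e + m) ≡ S (suc e + m) ℤ.+ S m) →
                  E ≈ₛ (factor (- + 1) e *ₛ S)
grow-recurrence e E S E-below E-above n with split (suc e) n
... | below n<w = trans (E-below n n<w) (sym (factor-mul-below (- + 1) e S n (ℕP.≤-pred n<w)))
... | above m   = trans (E-above m)
  (sym (trans (factor-mul-above (- + 1) e S m) (cong (ℤ._+_ (S (suc e + m))) (ℤP.*-identityˡ (S m)))))

divide-recurrence : ∀ e (E S : Series) → (∀ n → n < suc e → E n ≡ S n) →
                    (∀ m → E (suc e + m) ≡ S (suc e + m) ℤ.+ E m) →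
                    (factor (+ 1) e *ₛ E) ≈ₛ S
divide-recurrence e E S E-below E-above n with split (suc e) n
... | below n<w = trans (factor-mul-below (+ 1) e E n (ℕP.≤-pred n<w)) (E-below n n<w)
... | above m   = trans (factor-mul-above (+ 1) e E m)
  (trans (cong (λ x → x ℤ.+ - + 1 ℤ.* E m) (E-above m)) (cancel (S (suc e + m)) (E m)))
  where
  cancel : ∀ x y → x ℤ.+ y ℤ.+ - + 1 ℤ.* y ≡ x
  cancel = solve-∀

-- If each step b → b+1 contributes 1 − c q^(⌊b/2⌋+1), then
-- after b steps the exponents 1 … ⌊b/2⌋ and 1 … ⌈b/2⌉ have been used, i.e. the
-- accumulated factor is ∏_{i<⌊b/2⌋} · ∏_{i<⌈b/2⌉}; the indices match by computation,
-- since ⌊(b+1)/2⌋ = ⌈b/2⌉ and ⌈(b+1)/2⌉ = ⌊b/2⌋ + 1.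
pairedPoch : ℤ → ℕ → Series
pairedPoch c b = finPoch c 0 ⌊ b /2⌋ *ₛ finPoch c 0 ⌈ b /2⌉

absorb-factor : ∀ F A B → (F *ₛ (A *ₛ B)) ≈ₛ (B *ₛ (A *ₛ F))
absorb-factor F A B = prove 3 (f ⊕ (a ⊕ b)) (b ⊕ (a ⊕ f)) (F ∷ A ∷ B ∷ [])
  where
  f = var zero
  a = var (suc zero)
  b = var (suc (suc zero))

paired-product : ∀ c (S : ℕ → Series) →
                 (∀ b → S (suc b) ≈ₛ (factor c ⌊ b /2⌋ *ₛ S b)) →
                 ∀ b → S b ≈ₛ (pairedPoch c b *ₛ S 0)
paired-product c S step zero = begin
  S 0                          ≈⟨ *ₛ-identityˡ (S 0) ⟨
  oneₛ *ₛ S 0                  ≈⟨ *ₛ-congʳ (S 0) (*ₛ-identityˡ oneₛ) ⟨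
  (oneₛ *ₛ oneₛ) *ₛ S 0        ∎
  where open ≈ₛ-Reasoning
paired-product c S step (suc b) = begin
  S (suc b)                                    ≈⟨ step b ⟩
  F *ₛ S b                                     ≈⟨ *ₛ-congˡ F (paired-product c S step b) ⟩
  F *ₛ ((A *ₛ B) *ₛ S 0)                       ≈⟨ *ₛ-congˡ F (*ₛ-assoc A B (S 0)) ⟩
  F *ₛ (A *ₛ (B *ₛ S 0))                       ≈⟨ absorb-factor F A (B *ₛ S 0) ⟩
  (B *ₛ S 0) *ₛ (A *ₛ F)                       ≈⟨ *ₛ-comm (B *ₛ S 0) (A *ₛ F) ⟩
  (A *ₛ F) *ₛ (B *ₛ S 0)                       ≈⟨ *ₛ-assoc (A *ₛ F) B (S 0) ⟨
  ((A *ₛ F) *ₛ B) *ₛ S 0                       ≈⟨ *ₛ-congʳ (S 0) (*ₛ-comm (A *ₛ F) B) ⟩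
  pairedPoch c (suc b) *ₛ S 0                  ∎
  where
  open ≈ₛ-Reasoning
  F = factor c ⌊ b /2⌋
  A = finPoch c 0 ⌊ b /2⌋
  B = finPoch c 0 ⌈ b /2⌉

paired-quotient : ∀ c (S : ℕ → Series) →
                  (∀ b → (factor c ⌊ b /2⌋ *ₛ S (suc b)) ≈ₛ S b) →
                  ∀ b → (pairedPoch c b *ₛ S b) ≈ₛ S 0
paired-quotient c S step zero = begin
  (oneₛ *ₛ oneₛ) *ₛ S 0  ≈⟨ *ₛ-congʳ (S 0) (*ₛ-identityˡ oneₛ) ⟩
  oneₛ *ₛ S 0            ≈⟨ *ₛ-identityˡ (S 0) ⟩
  S 0                    ∎
  where open ≈ₛ-Reasoning
paired-quotient c S step (suc b) = begin
  (B *ₛ (A *ₛ F)) *ₛ S (suc b)  ≈⟨ regroup ⟩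
  (A *ₛ B) *ₛ (F *ₛ S (suc b))  ≈⟨ *ₛ-congˡ (A *ₛ B) (step b) ⟩
  (A *ₛ B) *ₛ S b               ≈⟨ paired-quotient c S step b ⟩
  S 0                           ∎
  where
  open ≈ₛ-Reasoning
  F = factor c ⌊ b /2⌋
  A = finPoch c 0 ⌊ b /2⌋
  B = finPoch c 0 ⌈ b /2⌉
  regroup : ((B *ₛ (A *ₛ F)) *ₛ S (suc b)) ≈ₛ ((A *ₛ B) *ₛ (F *ₛ S (suc b)))
  regroup = prove 4 ((y ⊕ (x ⊕ f)) ⊕ s) ((x ⊕ y) ⊕ (f ⊕ s)) (F ∷ A ∷ B ∷ S (suc b) ∷ [])
    where
    f = var zero
    x = var (suc zero)
    y = var (suc (suc zero))
    s = var (suc (suc (suc zero)))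

-- Truncation of the paired products: with b = 2n + 2 both halves exceed n, so
-- pairedPoch c b ≡ (c q; q)_∞² modulo q^(n+1).
pairedPoch-agree : ∀ c n → Agree n (pairedPoch c (2 + (n + n))) (poch c 0 *ₛ poch c 0)
pairedPoch-agree c n = *ₛ-cong-upTo (stable (ℕP.n≡⌊n+n/2⌋ n)) (stable (ℕP.n≡⌈n+n/2⌉ n))
  where
  stable : ∀ {N} → n ≡ N → Agree n (finPoch c 0 (suc N)) (poch c 0)
  stable refl j j≤n = finPoch-stable c 0 (suc n) j (s≤s j≤n)

-- A family lists, for every n, the objects of weight n.
Family : Set
Family = ℕ → List (List ℕ)

-- The definition is kept opaque: it is only ever used through extend-below/above.
opaque
  extend : ℕ → (List ℕ → List ℕ) → Family → Family → Family
  extend w g old new n with w ≤? n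
  ... | yes _ = old n ++ map g (new (n ∸ w))
  ... | no  _ = old n

module _ {w : ℕ} {g : List ℕ → List ℕ} {old new : Family} where

  opaque
   unfolding extend
   extend-below : ∀ {n} → n < w → extend w g old new n ≡ old n
   extend-below {n} n<w with w ≤? n
   ... | yes w≤n = ⊥-elim (ℕP.<⇒≱ n<w w≤n)
   ... | no  _   = refl

   extend-above : ∀ m → extend w g old new (w + m) ≡ old (w + m) ++ map g (new m)
   extend-above m with w ≤? w + m
   ... | yes _   = cong (λ k → old (w + m) ++ map g (new k)) (ℕP.m+n∸m≡n w m)
   ... | no  w≰n = ⊥-elim (w≰n (ℕP.m≤m+n w m))

  data Extended : ℕ → List ℕ → Set where
    from-old : ∀ {n π} → π ∈ old n → Extended n π
    from-new : ∀ {m σ} → σ ∈ new m → Extended (w + m) (g σ)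

  ∈-extend⁻ : ∀ {n π} → π ∈ extend w g old new n → Extended n π
  ∈-extend⁻ {n} π∈ with split w n
  ... | below n<w = from-old (subst (_ ∈_) (extend-below n<w) π∈)
  ... | above m with ∈-++⁻ (old (w + m)) (subst (_ ∈_) (extend-above m) π∈)
  ...   | inj₁ π∈old = from-old π∈old
  ...   | inj₂ π∈img with ∈-map⁻ g π∈img
  ...     | σ , σ∈new , refl = from-new σ∈new

  ∈-extend⁺-old : ∀ {n π} → π ∈ old n → π ∈ extend w g old new n
  ∈-extend⁺-old {n} π∈ with split w n
  ... | below n<w = subst (_ ∈_) (sym (extend-below n<w)) π∈
  ... | above m   = subst (_ ∈_) (sym (extend-above m)) (∈-++⁺ˡ π∈)

  ∈-extend⁺-new : ∀ {m σ} → σ ∈ new m → g σ ∈ extend w g old new (w + m)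
  ∈-extend⁺-new {m} σ∈ = subst (_ ∈_) (sym (extend-above m)) (∈-++⁺ʳ (old (w + m)) (∈-map⁺ g σ∈))

  extend-unique : (r : List ℕ → List ℕ) →
                  (∀ n → Unique (old n)) → (∀ m → Unique (new m)) →
                  (∀ {m σ} → σ ∈ new m → r (g σ) ≡ σ) →
                  (∀ {m σ} → σ ∈ new m → g σ ∉ old (w + m)) →
                  ∀ n → Unique (extend w g old new n)
  extend-unique r old! new! retract fresh n with split w n
  ... | below n<w = subst Unique (sym (extend-below n<w)) (old! n)
  ... | above m   = subst Unique (sym (extend-above m))
    (Unique.++⁺ (old! (w + m)) (map-unique (All.tabulate retract) (new! m)) disjoint)
    where
    map-unique : ∀ {xs} → All (λ σ → r (g σ) ≡ σ) xs → Unique xs → Unique (map g xs)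
    map-unique {xs} inv xs! =
      Unique.map⁻ {f = r} (subst Unique (sym (trans (sym (map-∘ xs)) (map-id-local inv))) xs!)
    disjoint : ∀ {π} → ¬ (π ∈ old (w + m) × π ∈ map g (new m))
    disjoint (π∈old , π∈img) with ∈-map⁻ g π∈img
    ... | σ , σ∈new , refl = fresh σ∈new π∈old

count : Family → Series
count F n = + length (F n)

count-extend-below : ∀ {w g old new n} → n < w → count (extend w g old new) n ≡ count old n
count-extend-below {w} {g} {old} {new} n<w = cong (+_ ∘ length) (extend-below {w} {g} {old} {new} n<w)

count-extend-above : ∀ {w g old new} m →
                     count (extend w g old new) (w + m) ≡ count old (w + m) ℤ.+ count new m
count-extend-above {w} {g} {old} {new} m = begin
  + length (extend w g old new (w + m))                ≡⟨ cong (+_ ∘ length) (extend-above {w} {g} {old} {new} m) ⟩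
  + length (old (w + m) ++ map g (new m))              ≡⟨ cong +_ (length-++ (old (w + m))) ⟩
  + (length (old (w + m)) + length (map g (new m)))    ≡⟨ cong (λ k → + (length (old (w + m)) + k))
                                                               (length-map g (new m)) ⟩
  + (length (old (w + m)) + length (new m))            ≡⟨ ℤP.pos-+ (length (old (w + m))) (length (new m)) ⟩
  count old (w + m) ℤ.+ count new m                    ∎
  where open ≡-Reasoning

cons-dominating : ∀ {R : ℕ → ℕ → Set} {x σ} → All (R x) σ → Linked R σ → Linked R (x ∷ σ)
cons-dominating []      []  = [-]
cons-dominating (p ∷ _) rel = p ∷ rel

head-dominates : ∀ {R : ℕ → ℕ → Set} → (∀ {x y z} → R x y → R y z → R x z) →
                 ∀ {x σ} → Linked R (x ∷ σ) → All (R x) σ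
head-dominates trans rel with Linked⇒AllPairs trans rel
... | x≻σ ∷ _ = x≻σ

>-trans : ∀ {x y z} → x > y → y > z → x > z
>-trans x>y y>z = ℕP.<-trans y>z x>y

≥-trans : ∀ {x y z} → x ℕ.≥ y → y ℕ.≥ z → x ℕ.≥ z
≥-trans x≥y y≥z = ℕP.≤-trans y≥z x≥y

-- Σᵢ ⌈λᵢ/2⌉, the statistic carried by distinct partitions (it equals 𝒪(π′), see O-conj).
ceilHalfSum : List ℕ → ℕ
ceilHalfSum π = sum (map ⌈_/2⌉ π)

-- Distinct partitions with parts ≤ b, by ceilHalfSum: either b is not a part, or it
-- is the largest part and contributes ⌈b/2⌉.
distinctFamily : ℕ → Family
distinctFamily zero    zero    = [] ∷ []
distinctFamily zero    (suc n) = []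
distinctFamily (suc b) n       = extend ⌈ suc b /2⌉ (suc b ∷_) (distinctFamily b) (distinctFamily b) n

BoundedDistinct : ℕ → List ℕ → Set
BoundedDistinct b π = IsDistinctPartition π × All (_≤ b) π

∈-distinct⁻ : ∀ b {n π} → π ∈ distinctFamily b n → BoundedDistinct b π × ceilHalfSum π ≡ n
∈-distinct⁻ zero    {zero} (here refl) = (([] , []) , []) , refl
∈-distinct⁻ (suc b) π∈ with ∈-extend⁻ π∈
... | from-old π∈old with ∈-distinct⁻ b π∈old
...   | (dist , bnd) , eq = (dist , All.map ℕP.m≤n⇒m≤1+n bnd) , eq
∈-distinct⁻ (suc b) π∈ | from-new σ∈new with ∈-distinct⁻ b σ∈new
...   | ((pos , dec) , bnd) , refl =
  ((z<s ∷ pos , cons-dominating (All.map s≤s bnd) dec) , ℕP.≤-refl ∷ All.map ℕP.m≤n⇒m≤1+n bnd) , refl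

∈-distinct⁺ : ∀ b {π} → BoundedDistinct b π → π ∈ distinctFamily b (ceilHalfSum π)
∈-distinct⁺ zero    {[]}    _                  = here refl
∈-distinct⁺ zero    {x ∷ σ} ((0<x ∷ _ , _) , x≤0 ∷ _) = ⊥-elim (ℕP.<⇒≱ 0<x x≤0)
∈-distinct⁺ (suc b) {[]}    _                  = ∈-extend⁺-old (∈-distinct⁺ b (([] , []) , []))
∈-distinct⁺ (suc b) {x ∷ σ} ((pos , dec) , x≤b+1 ∷ σ≤b+1) with ℕP.m≤n⇒m<n∨m≡n x≤b+1
... | inj₁ x<b+1 = ∈-extend⁺-old (∈-distinct⁺ b {x ∷ σ} ((pos , dec) , x≤b ∷ σ≤b))
  where
  x≤b = ℕP.≤-pred x<b+1
  σ≤b = All.map (λ y<x → ℕP.<⇒≤ (ℕP.<-≤-trans y<x x≤b)) (head-dominates >-trans dec)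
... | inj₂ refl  = ∈-extend⁺-new (∈-distinct⁺ b ((All.tail pos , Linked.tail dec) , σ≤b))
  where σ≤b = All.map ℕP.≤-pred (head-dominates >-trans dec)

distinct-unique : ∀ b n → Unique (distinctFamily b n)
distinct-unique zero    zero    = [] ∷ []
distinct-unique zero    (suc n) = []
distinct-unique (suc b) =
  extend-unique (drop 1) (distinct-unique b) (distinct-unique b) (λ _ → refl) fresh
  where
  -- every old member has all parts ≤ b, but the new ones start with b + 1
  fresh : ∀ {m σ} → σ ∈ distinctFamily b m → (suc b ∷ σ) ∉ distinctFamily b (⌈ suc b /2⌉ + m)
  fresh _ π∈ with ∈-distinct⁻ b π∈
  ... | (_ , b+1≤b ∷ _) , _ = ℕP.<-irrefl refl b+1≤b

distinct-step : ∀ b → count (distinctFamily (suc b)) ≈ₛ (factor (- + 1) ⌊ b /2⌋ *ₛ count (distinctFamily b))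
distinct-step b = grow-recurrence ⌊ b /2⌋ _ _ (λ _ n<w → count-extend-below n<w) count-extend-above

distinct-base : count (distinctFamily 0) ≈ₛ oneₛ
distinct-base zero    = refl
distinct-base (suc n) = refl

distinct-product : ∀ b → count (distinctFamily b) ≈ₛ pairedPoch (- + 1) b
distinct-product b = begin
  count (distinctFamily b)    ≈⟨ paired-product (- + 1) (count ∘ distinctFamily) distinct-step b ⟩
  P *ₛ count (distinctFamily 0) ≈⟨ *ₛ-congˡ P distinct-base ⟩
  P *ₛ oneₛ                   ≈⟨ *ₛ-comm P oneₛ ⟩
  oneₛ *ₛ P                   ≈⟨ *ₛ-identityˡ P ⟩
  P                           ∎
  where
  open ≈ₛ-Reasoning
  P = pairedPoch (- + 1) b

-- Entry j of conj π is the length of column j+1 of the diagram,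
-- a sum over the rows of π of the indicator that the row reaches that column; 𝒪 is
-- additive in the entries, and on a single row of length y it yields ⌈y/2⌉.
columnLength : ℕ → List ℕ → ℕ
columnLength j ys = length (filter (λ y → suc j ≤? y) ys)

inRow : ℕ → ℕ → ℕ
inRow j y = if suc j ℕ.≤ᵇ y then 1 else 0

columnLength-cons : ∀ j y ys → columnLength j (y ∷ ys) ≡ inRow j y + columnLength j ys
columnLength-cons j y ys with suc j ℕ.≤ᵇ y
... | true  = refl
... | false = refl

O-applyUpTo-zero : ∀ x → O (applyUpTo (λ _ → 0) x) ≡ 0
O-applyUpTo-zero zero          = refl
O-applyUpTo-zero (suc zero)    = refl
O-applyUpTo-zero (suc (suc x)) = O-applyUpTo-zero x

O-applyUpTo-+ : ∀ f g h x → (∀ j → f j ≡ g j + h j) →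
                O (applyUpTo f x) ≡ O (applyUpTo g x) + O (applyUpTo h x)
O-applyUpTo-+ f g h zero          f≡ = refl
O-applyUpTo-+ f g h (suc zero)    f≡ = f≡ 0
O-applyUpTo-+ f g h (suc (suc x)) f≡ = begin
  f 0 + O (applyUpTo f₂ x)                               ≡⟨ cong₂ _+_ (f≡ 0) (O-applyUpTo-+ f₂ g₂ h₂ x (λ j → f≡ (suc (suc j)))) ⟩
  (g 0 + h 0) + (O (applyUpTo g₂ x) + O (applyUpTo h₂ x)) ≡⟨ +-interchange (g 0) (h 0) _ _ ⟩
  (g 0 + O (applyUpTo g₂ x)) + (h 0 + O (applyUpTo h₂ x)) ∎
  where
  open ≡-Reasoning
  f₂ = λ j → f (suc (suc j))
  g₂ = λ j → g (suc (suc j))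
  h₂ = λ j → h (suc (suc j))

O-row : ∀ x y → y ≤ x → O (applyUpTo (λ j → inRow j y) x) ≡ ⌈ y /2⌉
O-row zero          zero          _                 = refl
O-row (suc zero)    zero          _                 = refl
O-row (suc zero)    (suc zero)    _                 = refl
O-row (suc zero)    (suc (suc y)) (s≤s ())
O-row (suc (suc x)) zero          _                 = O-applyUpTo-zero x
O-row (suc (suc x)) (suc zero)    _                 = cong suc (O-applyUpTo-zero x)
O-row (suc (suc x)) (suc (suc y)) (s≤s (s≤s y≤x)) = cong suc (O-row x y y≤x)

O-columns : ∀ x ys → All (_≤ x) ys → O (applyUpTo (λ j → columnLength j ys) x) ≡ ceilHalfSum ys
O-columns x []       []             = O-applyUpTo-zero x
O-columns x (y ∷ ys) (y≤x ∷ ys≤x) =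
  trans (O-applyUpTo-+ _ (λ j → inRow j y) (λ j → columnLength j ys) x (λ j → columnLength-cons j y ys))
        (cong₂ _+_ (O-row x y y≤x) (O-columns x ys ys≤x))

O-conj : ∀ π → Linked ℕ._≥_ π → O (conj π) ≡ ceilHalfSum π
O-conj []       _   = refl
O-conj (x ∷ xs) dec = O-columns x (x ∷ xs) (ℕP.≤-refl ∷ head-dominates ≥-trans dec)

addColumn : ℕ → List ℕ → List ℕ
addColumn zero    σ        = σ
addColumn (suc k) []       = 1 ∷ addColumn k []
addColumn (suc k) (x ∷ xs) = suc x ∷ addColumn k xs

removeColumn : List ℕ → List ℕ
removeColumn []                 = []
removeColumn (zero ∷ _)         = []
removeColumn (suc zero ∷ _)     = []
removeColumn (suc (suc x) ∷ xs) = suc x ∷ removeColumn xs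

length-addColumn : ∀ k σ → length σ ≤ k → length (addColumn k σ) ≡ k
length-addColumn zero    []       _         = refl
length-addColumn (suc k) []       _         = cong suc (length-addColumn k [] z≤n)
length-addColumn (suc k) (x ∷ xs) (s≤s len) = cong suc (length-addColumn k xs len)

-- The new column contributes its odd-indexed cells, ⌈k/2⌉ of them, to 𝒪.
O-addColumn : ∀ k σ → length σ ≤ k → O (addColumn k σ) ≡ ⌈ k /2⌉ + O σ
O-addColumn zero          []           _               = refl
O-addColumn (suc zero)    []           _               = refl
O-addColumn (suc zero)    (x ∷ [])     _               = refl
O-addColumn (suc zero)    (_ ∷ _ ∷ _)  (s≤s ())
O-addColumn (suc (suc k)) []           _               = cong suc (O-addColumn k [] z≤n)
O-addColumn (suc (suc k)) (x ∷ [])     _               =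
  trans (cong (_+_ (suc x)) (O-addColumn k [] z≤n)) (swap x ⌈ k /2⌉)
  where
  swap : ∀ x c → suc x + (c + 0) ≡ suc c + x
  swap = ℕSolver.solve-∀
O-addColumn (suc (suc k)) (x ∷ _ ∷ xs) (s≤s (s≤s len)) =
  trans (cong (_+_ (suc x)) (O-addColumn k xs len)) (swap x ⌈ k /2⌉ (O xs))
  where
  swap : ∀ x c o → suc x + (c + o) ≡ suc c + (x + o)
  swap = ℕSolver.solve-∀

addColumn-bounded : ∀ k σ {b} → All (_≤ b) σ → All (_≤ suc b) (addColumn k σ)
addColumn-bounded zero    σ        σ≤b          = All.map ℕP.m≤n⇒m≤1+n σ≤b
addColumn-bounded (suc k) []       []           = s≤s z≤n ∷ addColumn-bounded k [] []
addColumn-bounded (suc k) (x ∷ xs) (x≤b ∷ xs≤b) = s≤s x≤b ∷ addColumn-bounded k xs xs≤b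

addColumn-partition : ∀ k σ → IsPartition σ → IsPartition (addColumn k σ)
addColumn-partition k σ (pos , dec) = positive k σ pos , decreasing k σ dec
  where
  positive : ∀ k σ → All (0 <_) σ → All (0 <_) (addColumn k σ)
  positive zero    σ        pos       = pos
  positive (suc k) []       _         = z<s ∷ positive k [] []
  positive (suc k) (x ∷ xs) (_ ∷ pos) = z<s ∷ positive k xs pos
  decreasing : ∀ k σ → Linked ℕ._≥_ σ → Linked ℕ._≥_ (addColumn k σ)
  decreasing zero    σ        dec = dec
  decreasing (suc k) []       _   = cons-dominating (addColumn-bounded k [] {0} []) (decreasing k [] [])
  decreasing (suc k) (x ∷ xs) dec =
    cons-dominating (addColumn-bounded k xs (head-dominates ≥-trans dec)) (decreasing k xs (Linked.tail dec))

removeColumn-addColumn : ∀ k σ → All (0 <_) σ → length σ ≤ k → removeColumn (addColumn k σ) ≡ σ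
removeColumn-addColumn zero    []           _          _         = refl
removeColumn-addColumn (suc k) []           _          _         = refl
removeColumn-addColumn (suc k) (suc x ∷ xs) (_ ∷ pos) (s≤s len) =
  cong (suc x ∷_) (removeColumn-addColumn k xs pos len)

removeColumn-ones : ∀ xs → All (_≤ 1) xs → removeColumn xs ≡ []
removeColumn-ones []                 _               = refl
removeColumn-ones (zero ∷ _)         _               = refl
removeColumn-ones (suc zero ∷ _)     _               = refl
removeColumn-ones (suc (suc _) ∷ _) (s≤s () ∷ _)

addColumn-removeColumn : ∀ π → IsPartition π → addColumn (length π) (removeColumn π) ≡ π
addColumn-removeColumn []                 _                 = refl
addColumn-removeColumn (suc zero ∷ xs)    (_ ∷ pos , dec)   = cong (1 ∷_) (begin
  addColumn (length xs) []                 ≡⟨ cong (addColumn (length xs)) (removeColumn-ones xs xs≤1) ⟨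
  addColumn (length xs) (removeColumn xs)  ≡⟨ addColumn-removeColumn xs (pos , Linked.tail dec) ⟩
  xs                                       ∎)
  where
  open ≡-Reasoning
  xs≤1 = head-dominates ≥-trans dec
addColumn-removeColumn (suc (suc x) ∷ xs) (_ ∷ pos , dec)   =
  cong (suc (suc x) ∷_) (addColumn-removeColumn xs (pos , Linked.tail dec))

removeColumn-partition : ∀ π → IsPartition π → IsPartition (removeColumn π)
removeColumn-partition []                 _               = [] , []
removeColumn-partition (zero ∷ _)         _               = [] , []
removeColumn-partition (suc zero ∷ _)     _               = [] , []
removeColumn-partition (suc (suc x) ∷ xs) (_ ∷ pos , dec) with removeColumn-partition xs (pos , Linked.tail dec)
... | pos′ , dec′ = z<s ∷ pos′ , cons-dominating (bounded xs (head-dominates ≥-trans dec)) dec′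
  where
  bounded : ∀ xs {b} → All (_≤ suc b) xs → All (_≤ b) (removeColumn xs)
  bounded []                 _                = []
  bounded (zero ∷ _)         _                = []
  bounded (suc zero ∷ _)     _                = []
  bounded (suc (suc _) ∷ xs) (s≤s x≤b ∷ xs≤) = x≤b ∷ bounded xs xs≤

length-removeColumn : ∀ π → length (removeColumn π) ≤ length π
length-removeColumn []                 = z≤n
length-removeColumn (zero ∷ _)         = z≤n
length-removeColumn (suc zero ∷ _)     = z≤n
length-removeColumn (suc (suc _) ∷ xs) = s≤s (length-removeColumn xs)

-- Partitions with at most k parts, by 𝒪, listed correctly for weights below the fuel f:
-- either there are fewer than k parts, or exactly k, and then removing the first column
-- (height k, contributing ⌈k/2⌉ to 𝒪) leaves a partition with at most k parts.
-- Since ⌈k/2⌉ ≥ 1 the weight drops, which the fuel records.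
boundedLength : ℕ → ℕ → Family
boundedLength f       zero    zero    = [] ∷ []
boundedLength f       zero    (suc n) = []
boundedLength zero    (suc k) n       = []
boundedLength (suc f) (suc k) n       =
  extend ⌈ suc k /2⌉ (addColumn (suc k)) (boundedLength (suc f) k) (boundedLength f (suc k)) n

AtMostParts : ℕ → List ℕ → Set
AtMostParts k π = IsPartition π × length π ≤ k

∈-boundedLength⁻ : ∀ f k {n π} → π ∈ boundedLength f k n → AtMostParts k π × O π ≡ n
∈-boundedLength⁻ f       zero    {zero} (here refl) = (([] , []) , z≤n) , refl
∈-boundedLength⁻ (suc f) (suc k) π∈ with ∈-extend⁻ π∈
... | from-old π∈old with ∈-boundedLength⁻ (suc f) k π∈old
...   | (part , len) , eq = (part , ℕP.m≤n⇒m≤1+n len) , eq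
∈-boundedLength⁻ (suc f) (suc k) π∈ | from-new {σ = σ} σ∈new with ∈-boundedLength⁻ f (suc k) σ∈new
...   | (part , len) , refl =
  (addColumn-partition (suc k) σ part , ℕP.≤-reflexive (length-addColumn (suc k) σ len)) ,
  O-addColumn (suc k) σ len

∈-boundedLength⁺ : ∀ f k {π} → O π < f → AtMostParts k π → π ∈ boundedLength f k (O π)
∈-boundedLength⁺ f       zero    {[]}    _    _                = here refl
∈-boundedLength⁺ (suc f) (suc k) {π}     O<f (part , len) with ℕP.m≤n⇒m<n∨m≡n len
... | inj₁ (s≤s len≤k) = ∈-extend⁺-old (∈-boundedLength⁺ (suc f) k O<f (part , len≤k))
... | inj₂ len≡k+1      = subst (λ n → π ∈ boundedLength (suc f) (suc k) n) O-eq
  (subst (λ τ → τ ∈ boundedLength (suc f) (suc k) (⌈ suc k /2⌉ + O σ)) restore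
    (∈-extend⁺-new (∈-boundedLength⁺ f (suc k) Oσ<f (removeColumn-partition π part , σ-len))))
  where
  σ = removeColumn π
  σ-len = ℕP.≤-trans (length-removeColumn π) len
  restore : addColumn (suc k) σ ≡ π
  restore = subst (λ t → addColumn t σ ≡ π) len≡k+1 (addColumn-removeColumn π part)
  O-eq : ⌈ suc k /2⌉ + O σ ≡ O π
  O-eq = trans (sym (O-addColumn (suc k) σ σ-len)) (cong O restore)
  Oσ<f : O σ < f
  Oσ<f = ℕP.≤-<-trans (ℕP.m≤n+m (O σ) ⌊ k /2⌋) (ℕP.≤-pred (subst (_< suc f) (sym O-eq) O<f))

boundedLength-unique : ∀ f k n → Unique (boundedLength f k n)
boundedLength-unique f       zero    zero    = [] ∷ []
boundedLength-unique f       zero    (suc n) = []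
boundedLength-unique zero    (suc k) n       = []
boundedLength-unique (suc f) (suc k) =
  extend-unique removeColumn (boundedLength-unique (suc f) k) (boundedLength-unique f (suc k)) retract fresh
  where
  retract : ∀ {m σ} → σ ∈ boundedLength f (suc k) m → removeColumn (addColumn (suc k) σ) ≡ σ
  retract {σ = σ} σ∈ with ∈-boundedLength⁻ f (suc k) σ∈
  ... | ((pos , _) , len) , _ = removeColumn-addColumn (suc k) σ pos len
  -- old members have at most k parts, new ones exactly k + 1
  fresh : ∀ {m σ} → σ ∈ boundedLength f (suc k) m →
          addColumn (suc k) σ ∉ boundedLength (suc f) k (⌈ suc k /2⌉ + m)
  fresh {σ = σ} σ∈ π∈ with ∈-boundedLength⁻ f (suc k) σ∈ | ∈-boundedLength⁻ (suc f) k π∈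
  ... | (_ , σ-len) , _ | (_ , π-len) , _ =
    ℕP.<-irrefl refl (subst (_≤ k) (length-addColumn (suc k) σ σ-len) π-len)

boundedLength-fuel : ∀ f f′ k n → n < f → n < f′ → boundedLength f k n ≡ boundedLength f′ k n
boundedLength-fuel f       f′       zero    zero    _   _    = refl
boundedLength-fuel f       f′       zero    (suc n) _   _    = refl
boundedLength-fuel (suc f) (suc f′) (suc k) n       n<f n<f′ with split ⌈ suc k /2⌉ n
... | below n<w = trans (extend-below n<w)
                    (trans (boundedLength-fuel (suc f) (suc f′) k n n<f n<f′) (sym (extend-below n<w)))
... | above m   = trans (extend-above m)
                    (trans (cong₂ (λ xs ys → xs ++ map (addColumn (suc k)) ys)
                                  (boundedLength-fuel (suc f) (suc f′) k _ n<f n<f′)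
                                  (boundedLength-fuel f f′ (suc k) m (m<f n<f) (m<f n<f′)))
                           (sym (extend-above m)))
  where
  m<f : ∀ {g} → ⌈ suc k /2⌉ + m < suc g → m < g
  m<f w+m<g = ℕP.≤-<-trans (ℕP.m≤n+m m ⌊ k /2⌋) (ℕP.≤-pred w+m<g)

partsFamily : ℕ → Family
partsFamily k n = boundedLength (suc n) k n

parts-step : ∀ k → (factor (+ 1) ⌊ k /2⌋ *ₛ count (partsFamily (suc k))) ≈ₛ count (partsFamily k)
parts-step k = divide-recurrence ⌊ k /2⌋ _ _ (λ _ n<w → count-extend-below n<w) heavy
  where
  heavy : ∀ m → count (partsFamily (suc k)) (⌈ suc k /2⌉ + m)
              ≡ count (partsFamily k) (⌈ suc k /2⌉ + m) ℤ.+ count (partsFamily (suc k)) m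
  heavy m = trans (count-extend-above m)
    (cong (λ xs → count (partsFamily k) (⌈ suc k /2⌉ + m) ℤ.+ + length xs)
          (boundedLength-fuel _ (suc m) (suc k) m (s≤s (ℕP.m≤n+m m ⌊ k /2⌋)) ℕP.≤-refl))

parts-base : count (partsFamily 0) ≈ₛ oneₛ
parts-base zero    = refl
parts-base (suc n) = refl

-- Partitions of 𝒪-weight n have at most 2n parts, so beyond k = 2n nothing changes.
parts-stable : ∀ {n k} → n + n ℕ.≤′ k → partsFamily k n ≡ partsFamily (n + n) n
parts-stable                ℕ.≤′-refl        = refl
parts-stable {n} {suc k} (ℕ.≤′-step 2n≤k) = trans (extend-below (s≤s n≤⌊k/2⌋)) (parts-stable 2n≤k)
  where
  n≤⌊k/2⌋ : n ≤ ⌊ k /2⌋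
  n≤⌊k/2⌋ = subst (_≤ ⌊ k /2⌋) (sym (ℕP.n≡⌊n+n/2⌋ n)) (ℕP.⌊n/2⌋-mono (ℕP.≤′⇒≤ 2n≤k))

-- 𝒪 takes every other part and all parts are ≥ 1, so length π ≤ 2 𝒪(π).
length≤2O : ∀ π → All (0 <_) π → length π ≤ O π + O π
length≤2O []           _               = z≤n
length≤2O (x ∷ [])     (0<x ∷ _)       = ℕP.≤-trans 0<x (ℕP.m≤m+n x x)
length≤2O (x ∷ _ ∷ xs) (0<x ∷ _ ∷ pos) = begin
  suc (suc (length xs))         ≤⟨ s≤s (s≤s (length≤2O xs pos)) ⟩
  suc (suc (O xs + O xs))       ≡⟨ cong suc (ℕP.+-suc (O xs) (O xs)) ⟨
  suc (O xs) + suc (O xs)       ≤⟨ ℕP.+-mono-≤ grow grow ⟩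
  (x + O xs) + (x + O xs)       ∎
  where
  open ℕP.≤-Reasoning
  grow : suc (O xs) ≤ x + O xs
  grow = ℕP.+-monoˡ-≤ (O xs) 0<x

-- Every part y of a list satisfies y ≤ 2⌈y/2⌉ ≤ 2 Σ ⌈λᵢ/2⌉.
part≤2ceilHalfSum : ∀ π → All (_≤ ceilHalfSum π + ceilHalfSum π) π
part≤2ceilHalfSum []       = []
part≤2ceilHalfSum (y ∷ ys) =
  ℕP.≤-trans y≤2⌈y/2⌉ (ℕP.+-mono-≤ (ℕP.m≤m+n ⌈ y /2⌉ _) (ℕP.m≤m+n ⌈ y /2⌉ _)) ∷
  All.map (λ z≤ → ℕP.≤-trans z≤ (ℕP.+-mono-≤ (ℕP.m≤n+m _ ⌈ y /2⌉) (ℕP.m≤n+m _ ⌈ y /2⌉)))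
          (part≤2ceilHalfSum ys)
  where
  y≤2⌈y/2⌉ : y ≤ ⌈ y /2⌉ + ⌈ y /2⌉
  y≤2⌈y/2⌉ = subst (_≤ ⌈ y /2⌉ + ⌈ y /2⌉) (ℕP.⌊n/2⌋+⌈n/2⌉≡n y) (ℕP.+-monoˡ-≤ ⌈ y /2⌉ (ℕP.⌊n/2⌋≤⌈n/2⌉ y))

partitionCount : ℕ → ℕ
partitionCount n = length (partsFamily (n + n) n)

partitions-counted : ∀ n → CountedBy (partitionCount n) (λ π → IsPartition π × O π ≡ n)
partitions-counted n =
  partsFamily (n + n) n , boundedLength-unique (suc n) (n + n) n , (λ π → mk⇔ (member π) (enumerated π)) , refl
  where
  member : ∀ π → π ∈ partsFamily (n + n) n → IsPartition π × O π ≡ n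
  member π π∈ with ∈-boundedLength⁻ (suc n) (n + n) π∈
  ... | (part , _) , eq = part , eq
  enumerated : ∀ π → IsPartition π × O π ≡ n → π ∈ partsFamily (n + n) n
  enumerated π (part , eq) = subst (λ k → π ∈ partsFamily (k + k) k) eq
    (∈-boundedLength⁺ (suc (O π)) (O π + O π) ℕP.≤-refl (part , length≤2O π (proj₁ part)))

partitions-series : (fromℕseq partitionCount *ₛ (qq∞ *ₛ qq∞)) ≈ₛ oneₛ
partitions-series n = begin
  (fromℕseq partitionCount *ₛ (qq∞ *ₛ qq∞)) n      ≡⟨ *ₛ-cong-upTo stable truncate n ℕP.≤-refl ⟩
  (count (partsFamily b) *ₛ pairedPoch (+ 1) b) n  ≡⟨ *ₛ-comm (count (partsFamily b)) (pairedPoch (+ 1) b) n ⟩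
  (pairedPoch (+ 1) b *ₛ count (partsFamily b)) n  ≡⟨ paired-quotient (+ 1) (count ∘ partsFamily) parts-step b n ⟩
  count (partsFamily 0) n                          ≡⟨ parts-base n ⟩
  oneₛ n                                           ∎
  where
  open ≡-Reasoning
  b = 2 + (n + n)
  stable : Agree n (fromℕseq partitionCount) (count (partsFamily b))
  stable j j≤n = cong (+_ ∘ length) (sym (parts-stable (ℕP.≤⇒≤′ 2j≤b)))
    where 2j≤b = ℕP.≤-trans (ℕP.+-mono-≤ j≤n j≤n) (ℕP.m≤n+m (n + n) 2)
  truncate : Agree n (qq∞ *ₛ qq∞) (pairedPoch (+ 1) b)
  truncate j j≤n = sym (pairedPoch-agree (+ 1) n j j≤n)

distinctCount : ℕ → ℕ
distinctCount n = length (distinctFamily (2 + (n + n)) n)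

distinct-counted : ∀ n → CountedBy (distinctCount n) (λ π → IsDistinctPartition π × O (conj π) ≡ n)
distinct-counted n =
  distinctFamily b n , distinct-unique b n , (λ π → mk⇔ (member π) (enumerated π)) , refl
  where
  b = 2 + (n + n)
  O-conj-distinct : ∀ π → IsDistinctPartition π → O (conj π) ≡ ceilHalfSum π
  O-conj-distinct π (_ , dec) = O-conj π (Linked.map ℕP.<⇒≤ dec)
  member : ∀ π → π ∈ distinctFamily b n → IsDistinctPartition π × O (conj π) ≡ n
  member π π∈ with ∈-distinct⁻ b π∈
  ... | (dist , _) , eq = dist , trans (O-conj-distinct π dist) eq
  enumerated : ∀ π → IsDistinctPartition π × O (conj π) ≡ n → π ∈ distinctFamily b n
  enumerated π (dist , eq) = subst (λ k → π ∈ distinctFamily b k) weight (∈-distinct⁺ b (dist , bounded))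
    where
    weight = trans (sym (O-conj-distinct π dist)) eq
    bounded : All (_≤ b) π
    bounded = All.map (λ y≤ → ℕP.≤-trans (subst (λ k → _ ≤ k + k) weight y≤) (ℕP.m≤n+m (n + n) 2))
                      (part≤2ceilHalfSum π)

distinct-series : fromℕseq distinctCount ≈ₛ (mqq∞ *ₛ mqq∞)
distinct-series n = trans (distinct-product b n) (pairedPoch-agree (- + 1) n n ℕP.≤-refl)
  where b = 2 + (n + n)

theorem12 :
    (Σ (ℕ → ℕ) λ c →
       (∀ n → CountedBy (c n) (λ π → IsPartition π × O π ≡ n))
       × ((fromℕseq c *ₛ (qq∞ *ₛ qq∞)) ≈ₛ oneₛ))
    ×
    (Σ (ℕ → ℕ) λ d →
       (∀ n → CountedBy (d n) (λ π → IsDistinctPartition π × O (conj π) ≡ n))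
       × (fromℕseq d ≈ₛ (mqq∞ *ₛ mqq∞)))
theorem12 = (partitionCount , partitions-counted , partitions-series)
          , (distinctCount , distinct-counted , distinct-series)
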